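{- Let $\Omega$ be the space of all simplicial subcomplexes of $\Delta_{\mathbb N}$, with the metric $d$ described below, and let $\mathcal R\subseteq\Omega$ be the set of complexes isomorphic to the Rado complex. Then $\mathcal R$ is residual in $\Omega$ (its complement is a countable union of nowhere dense sets), and therefore $\mathcal R$ is dense in $\Omega$.
   Context: $\Delta_{\mathbb N}$ is the simplicial complex with vertex set $\mathbb N=\{1,2,\dots\}$ whose simplexes are all finite nonempty subsets of $\mathbb N$; $\Delta_n\subseteq\Delta_{\mathbb N}$ is the full simplex on $\{1,\dots,n\}$. $\Omega$ is the set of all subcomplexes $X\subseteq\Delta_{\mathbb N}$. For $X\in\Omega$ put $X_n=X\cap\Delta_n$; for $X,Y\in\Omega$ let $h(X,Y)=\max\{n: X_n=Y_n\}$ (with $\Delta_0=\emptyset$, and $h=\infty$ if $X=Y$), and $d(X,Y)=\exp(-h(X,Y))$. This metric induces the inverse limit topology $\Omega=\varprojlim\Omega_n$, where $\Omega_n$ is the finite discrete set of subcomplexes of $\Delta_n$; $\Omega$ is compact. For $U\subseteq V(X)$, $X_U$ is the induced subcomplex; $\mathrm{Lk}_X(v)$ is the subcomplex of simplexes $\sigma$ with $v\notin\sigma$, $\sigma\cup\{v\}\in X$. The Rado complex is the unique (up to isomorphism) simplicial complex with a countable vertex set which is nonempty and satisfies: for every finite $U\subseteq V(X)$ and every subcomplex $A\subseteq X_U$ there exists $v\in V(X)\setminus U$ with $\mathrm{Lk}_X(v)\cap X_U=A$. -}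

module Defs where

open import Data.Nat using (ℕ; _<_; _≟_)
open import Data.Bool using (Bool; true; false; _∧_; not)
open import Data.Bool.ListAction using (any; all)
open import Data.List using (List; []; _∷_; map)
open import Data.List.Relation.Unary.All using (All)
open import Data.List.Membership.Propositional using (_∈_)
open import Data.Product using (Σ; ∃; ∃-syntax; _×_)
open import Relation.Binary.PropositionalEquality using (_≡_; _≢_)
open import Relation.Nullary using (¬_)
open import Relation.Nullary.Decidable using (⌊_⌋)

-- Vertices: the paper's vertex i ∈ {1,2,…} is encoded as i-1 ∈ ℕ = {0,1,…};
-- so Δ_n is the full simplex on {0,…,n-1}.
-- A finite vertex set / simplex is encoded by a list (order and repetition irrelevant).

_⊆ˡ_ : List ℕ → List ℕ → Set
σ ⊆ˡ τ = All (_∈ τ) σ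

_∈ᵇ_ : ℕ → List ℕ → Bool
v ∈ᵇ σ = any (λ u → ⌊ v ≟ u ⌋) σ

nonEmptyᵇ : List ℕ → Bool
nonEmptyᵇ [] = false
nonEmptyᵇ (_ ∷ _) = true

-- A point of Ω: a subcomplex of Δ_ℕ, given by its (characteristic function of its)
-- set of simplices.
record Complex : Set where
  field
    mem      : List ℕ → Bool
    mem-[]   : mem [] ≡ false
    mem-ext  : ∀ σ τ → σ ⊆ˡ τ → τ ⊆ˡ σ → mem σ ≡ mem τ
    mem-down : ∀ σ τ → σ ⊆ˡ τ → σ ≢ [] → mem τ ≡ true → mem σ ≡ true
open Complex public

InΔ : ℕ → List ℕ → Set
InΔ n σ = All (_< n) σ

-- X_n = Y_n   (i.e. h(X,Y) ≥ n, i.e. d(X,Y) ≤ e^{-n})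
Agree : ℕ → Complex → Complex → Set
Agree n X Y = ∀ σ → InΔ n σ → mem X σ ≡ mem Y σ

Vertex : Complex → ℕ → Set
Vertex X v = mem X (v ∷ []) ≡ true

Induced : Complex → List ℕ → List ℕ → Bool
Induced X U σ = all (λ u → u ∈ᵇ U) σ ∧ mem X σ

Link : Complex → ℕ → List ℕ → Bool
Link X v σ = nonEmptyᵇ σ ∧ (not (v ∈ᵇ σ) ∧ mem X (v ∷ σ))

SubcomplexOf : Complex → (List ℕ → Bool) → Set
SubcomplexOf A P = ∀ σ → mem A σ ≡ true → P σ ≡ true

ExtensionProperty : Complex → Set
ExtensionProperty X =
  (U : List ℕ) → All (Vertex X) U →
  (A : Complex) → SubcomplexOf A (Induced X U) →
  ∃[ v ] (Vertex X v × ¬ (v ∈ U) ×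
          (∀ σ → (Link X v σ ∧ Induced X U σ) ≡ mem A σ))

-- X is a Rado complex (countable vertex set automatic: V(X) ⊆ ℕ)
IsRado : Complex → Set
IsRado X = (∃[ v ] Vertex X v) × ExtensionProperty X

Iso : Complex → Complex → Set
Iso X Y = Σ (ℕ → ℕ) λ f → Σ (ℕ → ℕ) λ g →
    (∀ v → Vertex X v → Vertex Y (f v) × g (f v) ≡ v)
  × (∀ w → Vertex Y w → Vertex X (g w) × f (g w) ≡ w)
  × (∀ σ → All (Vertex X) σ → mem X σ ≡ mem Y (map f σ))

RadoClass : Complex → Set
RadoClass X = ∃[ Y ] (IsRado Y × Iso Y X)

-- topology of Ω (basic clopen sets: {Y | Y_n = X_n})
IsOpen : (Complex → Set) → Set
IsOpen G = ∀ X → G X → ∃[ n ] (∀ Y → Agree n X Y → G Y)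

IsDense : (Complex → Set) → Set
IsDense P = ∀ X n → ∃[ Y ] (Agree n X Y × P Y)

Residual : (Complex → Set) → Set₁
Residual P = Σ (ℕ → Complex → Set) λ G →
  (∀ k → IsOpen (G k)) × (∀ k → IsDense (G k)) × (∀ X → (∀ k → G k X) → P X)

-- A complex is Rado as soon as it solves every "task" (U , F): having a vertex
-- v ∉ U whose link meets X_U exactly in the subcomplex generated by the faces F.  There are
-- countably many tasks, and for each the complexes solving it form an open set (the solution
-- only involves simplices on U ∪ {v}) which is dense: below any radius n, glue a new vertex
-- w ≥ n coning off X_U ∩ ⟨F⟩; this does not change X_n.  Density then follows by Baire's
-- theorem for the complete ultrametric space Ω.

module Submission where

open import Defs
open import Data.Nat using (ℕ; zero; suc; _+_; _<_; _≤_; _≟_; z≤n; s≤s; _≤′_; ≤′-refl; ≤′-step)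
open import Data.Nat.Properties using (<-irrefl; <-≤-trans; m≤m+n; m≤n+m; ≤-refl; ≤-trans; <⇒≤; ≤-total; ≤⇒≤′; n≤1+n)
open import Data.Nat.Binary.Base using (ℕᵇ; 2[1+_]; 1+[2_]; fromℕ) renaming (zero to 0ᵇ; toℕ to toℕᵇ)
open import Data.Nat.Binary.Properties using (fromℕ-toℕ)
open import Data.Bool using (Bool; true; false; _∧_; _∨_; not; if_then_else_)
open import Data.Bool.Properties using (∧-conicalˡ; ∧-conicalʳ; ∧-zeroʳ; ∧-comm; ⇔→≡; ¬-not)
  renaming (_≟_ to _≟ᵇ_)
open import Data.Bool.ListAction using (any; all)
open import Data.List using (List; []; _∷_; map; replicate; _++_; null; filter)
open import Data.List.Properties using (map-id)
open import Data.List.Relation.Unary.All as All using (All; []; _∷_)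
open import Data.List.Relation.Unary.Any using (here; there)
open import Data.List.Membership.Propositional using (_∈_; _∉_)
open import Data.List.Membership.Propositional.Properties using (∈-filter⁺; ∈-filter⁻; ∈-++⁺ˡ; ∈-++⁺ʳ; ∈-map⁺)
open import Data.List.Membership.DecPropositional _≟_ using (_∈?_)
open import Data.Product using (∃-syntax; _×_; _,_; proj₁; proj₂)
open import Data.Sum using (inj₁; inj₂)
open import Function.Base using (_∘_)
open import Function.Bundles using (Surjection; _↠_; mk↠ₛ; mk⇔)
open import Function.Construct.Composition using (_↠-∘_)
open import Function.Definitions using (StrictlySurjective)
open import Relation.Binary.PropositionalEquality
open import Relation.Nullary using (yes; no; ¬?; does; contradiction)
open import Relation.Unary using (Decidable)

∈ᵇ⇒∈ : ∀ {v} σ → v ∈ᵇ σ ≡ true → v ∈ σ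
∈ᵇ⇒∈ {v} (u ∷ σ) v∈σ with v ≟ u
... | yes refl = here refl
... | no _     = there (∈ᵇ⇒∈ σ v∈σ)

∈⇒∈ᵇ : ∀ {v σ} → v ∈ σ → v ∈ᵇ σ ≡ true
∈⇒∈ᵇ {v} (here refl) with v ≟ v
... | yes _  = refl
... | no v≢v = contradiction refl v≢v
∈⇒∈ᵇ {v} {u ∷ _} (there v∈σ) with v ≟ u
... | yes _ = refl
... | no _  = ∈⇒∈ᵇ v∈σ

∉⇒∈ᵇ≡false : ∀ {v σ} → v ∉ σ → v ∈ᵇ σ ≡ false
∉⇒∈ᵇ≡false v∉σ = ¬-not (λ v∈σ → v∉σ (∈ᵇ⇒∈ _ v∈σ))

∈ᵇ≡false⇒∉ : ∀ {v σ} → v ∈ᵇ σ ≡ false → v ∉ σ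
∈ᵇ≡false⇒∉ v∉σ v∈σ = contradiction (trans (sym (∈⇒∈ᵇ v∈σ)) v∉σ) λ ()

all-∈ᵇ⇒⊆ˡ : ∀ σ {τ} → all (_∈ᵇ τ) σ ≡ true → σ ⊆ˡ τ
all-∈ᵇ⇒⊆ˡ []      _   = []
all-∈ᵇ⇒⊆ˡ (u ∷ σ) σ⊆τ = ∈ᵇ⇒∈ _ (∧-conicalˡ _ _ σ⊆τ) ∷ all-∈ᵇ⇒⊆ˡ σ (∧-conicalʳ _ _ σ⊆τ)

⊆ˡ⇒all-∈ᵇ : ∀ {σ} τ → σ ⊆ˡ τ → all (_∈ᵇ τ) σ ≡ true
⊆ˡ⇒all-∈ᵇ τ []          = refl
⊆ˡ⇒all-∈ᵇ τ (u∈τ ∷ σ⊆τ) = cong₂ _∧_ (∈⇒∈ᵇ u∈τ) (⊆ˡ⇒all-∈ᵇ τ σ⊆τ)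

any⇒∃ : ∀ {A : Set} (p : A → Bool) xs → any p xs ≡ true → ∃[ x ] (x ∈ xs × p x ≡ true)
any⇒∃ p (x ∷ xs) h with p x in px
... | true  = x , here refl , px
... | false with any⇒∃ p xs h
...   | y , y∈xs , py = y , there y∈xs , py

∃⇒any : ∀ {A : Set} (p : A → Bool) {xs x} → x ∈ xs → p x ≡ true → any p xs ≡ true
∃⇒any p {x ∷ _} (here refl) px rewrite px = refl
∃⇒any p {y ∷ _} (there x∈xs) px with p y
... | true  = refl
... | false = ∃⇒any p x∈xs px

∧-absorbs-implied : ∀ {a b} → (a ≡ true → b ≡ true) → a ∧ b ≡ a
∧-absorbs-implied {false} _   = refl
∧-absorbs-implied {true}  a⇒b = a⇒b refl

All-⊆ˡ : ∀ {P : ℕ → Set} {σ τ} → σ ⊆ˡ τ → All P τ → All P σ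
All-⊆ˡ σ⊆τ Pτ = All.map (All.lookup Pτ) σ⊆τ

⊆ˡ-trans : ∀ {σ τ ρ} → σ ⊆ˡ τ → τ ⊆ˡ ρ → σ ⊆ˡ ρ
⊆ˡ-trans = All-⊆ˡ

⊆ˡ-[] : ∀ {σ} → σ ⊆ˡ [] → σ ≡ []
⊆ˡ-[] []        = refl
⊆ˡ-[] (() ∷ _)

⊆ˡ-nonEmpty : ∀ {σ τ} → σ ⊆ˡ τ → σ ≢ [] → τ ≢ []
⊆ˡ-nonEmpty σ⊆τ σ≢[] refl = σ≢[] (⊆ˡ-[] σ⊆τ)

InΔ-mono : ∀ {m n σ} → m ≤ n → InΔ m σ → InΔ n σ
InΔ-mono m≤n = All.map (λ u<m → <-≤-trans u<m m≤n)

InΔ⇒∉ : ∀ {w σ} → InΔ w σ → w ∉ σ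
InΔ⇒∉ σ<w w∈σ = <-irrefl refl (All.lookup σ<w w∈σ)

bound : List ℕ → ℕ
bound []      = 0
bound (u ∷ σ) = suc u + bound σ

InΔ-bound : ∀ σ → InΔ (bound σ) σ
InΔ-bound []      = []
InΔ-bound (u ∷ σ) = m≤m+n (suc u) (bound σ) ∷ InΔ-mono (m≤n+m (bound σ) (suc u)) (InΔ-bound σ)

Agree-mono : ∀ {m n X Y} → m ≤ n → Agree n X Y → Agree m X Y
Agree-mono m≤n X≐Y σ σ<m = X≐Y σ (InΔ-mono m≤n σ<m)

-- Complexes from down-closed predicates

DownClosed : (List ℕ → Bool) → Set
DownClosed f = ∀ σ τ → σ ⊆ˡ τ → σ ≢ [] → f τ ≡ true → f σ ≡ true

mkComplex : (f : List ℕ → Bool) → f [] ≡ false → DownClosed f → Complex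
mkComplex f f[]≡false down = record
  { mem = f ; mem-[] = f[]≡false ; mem-ext = extensional ; mem-down = down }
  where
  extensional : ∀ σ τ → σ ⊆ˡ τ → τ ⊆ˡ σ → f σ ≡ f τ
  extensional []        τ _   τ⊆σ rewrite ⊆ˡ-[] τ⊆σ = refl
  extensional σ@(_ ∷ _) τ σ⊆τ τ⊆σ = ⇔→≡ (mk⇔
    (down τ σ τ⊆σ (⊆ˡ-nonEmpty σ⊆τ λ ()))
    (down σ τ σ⊆τ λ ()))

_∩ᶜ_ : Complex → Complex → Complex
A ∩ᶜ B = mkComplex (λ σ → mem A σ ∧ mem B σ) (cong (_∧ mem B []) (mem-[] A)) down
  where
  down : DownClosed (λ σ → mem A σ ∧ mem B σ)
  down σ τ σ⊆τ σ≢[] στ = cong₂ _∧_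
    (mem-down A σ τ σ⊆τ σ≢[] (∧-conicalˡ _ _ στ))
    (mem-down B σ τ σ⊆τ σ≢[] (∧-conicalʳ _ _ στ))

induced : Complex → List ℕ → Complex
induced X U = mkComplex (Induced X U) (mem-[] X) down
  where
  down : DownClosed (Induced X U)
  down σ τ σ⊆τ σ≢[] τ∈X_U = cong₂ _∧_
    (⊆ˡ⇒all-∈ᵇ U (⊆ˡ-trans σ⊆τ (all-∈ᵇ⇒⊆ˡ τ (∧-conicalˡ _ _ τ∈X_U))))
    (mem-down X σ τ σ⊆τ σ≢[] (∧-conicalʳ _ _ τ∈X_U))

Generated : List (List ℕ) → List ℕ → Bool
Generated F σ = nonEmptyᵇ σ ∧ any (λ τ → all (_∈ᵇ τ) σ) F

nonEmptyᵇ-true : ∀ {σ} → σ ≢ [] → nonEmptyᵇ σ ≡ true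
nonEmptyᵇ-true {[]}    σ≢[] = contradiction refl σ≢[]
nonEmptyᵇ-true {_ ∷ _} _    = refl

generated : List (List ℕ) → Complex
generated F = mkComplex (Generated F) refl down
  where
  down : DownClosed (Generated F)
  down σ τ σ⊆τ σ≢[] τ∈⟨F⟩ with any⇒∃ _ F (∧-conicalʳ _ _ τ∈⟨F⟩)
  ... | ρ , ρ∈F , τ⊆ρ = cong₂ _∧_ (nonEmptyᵇ-true σ≢[])
    (∃⇒any _ ρ∈F (⊆ˡ⇒all-∈ᵇ ρ (⊆ˡ-trans σ⊆τ (all-∈ᵇ⇒⊆ˡ τ τ⊆ρ))))

-- Coning off a subcomplex

remove : ℕ → List ℕ → List ℕ
remove w = filter (λ u → ¬? (u ≟ w))

∈-remove⁺ : ∀ {w x} σ → x ∈ σ → x ≢ w → x ∈ remove w σ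
∈-remove⁺ {w} _ = ∈-filter⁺ (λ u → ¬? (u ≟ w))

∈-remove⁻ : ∀ {w x} σ → x ∈ remove w σ → x ∈ σ × x ≢ w
∈-remove⁻ {w} _ = ∈-filter⁻ (λ u → ¬? (u ≟ w))

withEmpty : Complex → List ℕ → Bool
withEmpty K τ = null τ ∨ mem K τ

withEmpty-down : ∀ K {σ τ} → σ ⊆ˡ τ → withEmpty K τ ≡ true → withEmpty K σ ≡ true
withEmpty-down K {[]}         _          _  = refl
withEmpty-down K {_ ∷ _} {[]} (() ∷ _)   _
withEmpty-down K {σ@(_ ∷ _)} {τ@(_ ∷ _)} σ⊆τ Kτ = mem-down K σ τ σ⊆τ (λ ()) Kτ

withEmpty-ext : ∀ K {σ τ} → σ ⊆ˡ τ → τ ⊆ˡ σ → withEmpty K σ ≡ withEmpty K τ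
withEmpty-ext K σ⊆τ τ⊆σ = ⇔→≡ (mk⇔ (withEmpty-down K τ⊆σ) (withEmpty-down K σ⊆τ))

withEmpty-nonEmpty : ∀ K {τ} → τ ≢ [] → withEmpty K τ ≡ true → mem K τ ≡ true
withEmpty-nonEmpty K {[]}    τ≢[] _  = contradiction refl τ≢[]
withEmpty-nonEmpty K {_ ∷ _} _    Kτ = Kτ

nonEmptyᵇ∧withEmpty : ∀ K σ → nonEmptyᵇ σ ∧ withEmpty K σ ≡ mem K σ
nonEmptyᵇ∧withEmpty K []      = sym (mem-[] K)
nonEmptyᵇ∧withEmpty K (_ ∷ _) = refl

-- The star of w in Z is replaced by the cone w ∗ K (the apex w itself included).
module Cone (Z K : Complex) (K⊆Z : SubcomplexOf K (mem Z)) (w : ℕ) where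

  coneMem : List ℕ → Bool
  coneMem σ = if w ∈ᵇ σ then withEmpty K (remove w σ) else mem Z σ

  coneMem-down : DownClosed coneMem
  coneMem-down σ τ σ⊆τ σ≢[] στ with w ∈ᵇ τ in w∈τ | w ∈ᵇ σ in w∈σ
  ... | false | false = mem-down Z σ τ σ⊆τ σ≢[] στ
  ... | false | true  = contradiction (All.lookup σ⊆τ (∈ᵇ⇒∈ σ w∈σ)) (∈ᵇ≡false⇒∉ w∈τ)
  ... | true  | true  = withEmpty-down K
    (All.tabulate λ x∈σ∖w → let x∈σ , x≢w = ∈-remove⁻ σ x∈σ∖w in
      ∈-remove⁺ τ (All.lookup σ⊆τ x∈σ) x≢w) στ
  ... | true  | false = K⊆Z σ
    (mem-down K σ (remove w τ) σ⊆τ∖w σ≢[]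
      (withEmpty-nonEmpty K (⊆ˡ-nonEmpty σ⊆τ∖w σ≢[]) στ))
    where
    σ⊆τ∖w : σ ⊆ˡ remove w τ
    σ⊆τ∖w = All.tabulate λ x∈σ → ∈-remove⁺ τ (All.lookup σ⊆τ x∈σ)
      λ { refl → ∈ᵇ≡false⇒∉ w∈σ x∈σ }

  cone : Complex
  cone = mkComplex coneMem (mem-[] Z) coneMem-down

  cone-away : ∀ {σ} → w ∉ σ → mem cone σ ≡ mem Z σ
  cone-away w∉σ rewrite ∉⇒∈ᵇ≡false w∉σ = refl

  cone-apex : ∀ {σ} → w ∉ σ → mem cone (w ∷ σ) ≡ withEmpty K σ
  cone-apex {σ} w∉σ rewrite ∈⇒∈ᵇ {w} {w ∷ σ} (here refl) = withEmpty-ext K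
    (All.tabulate λ x∈ → let x∈w∷σ , x≢w = ∈-remove⁻ (w ∷ σ) x∈ in tail-of x∈w∷σ x≢w)
    (All.tabulate λ x∈σ → ∈-remove⁺ (w ∷ σ) (there x∈σ) λ { refl → w∉σ x∈σ })
    where
    tail-of : ∀ {x} → x ∈ w ∷ σ → x ≢ w → x ∈ σ
    tail-of (here x≡w) x≢w = contradiction x≡w x≢w
    tail-of (there x∈σ) _  = x∈σ

  cone-agree : Agree w Z cone
  cone-agree σ σ<w = sym (cone-away (InΔ⇒∉ σ<w))

  cone-link : ∀ {U} → SubcomplexOf K (Induced Z U) → InΔ w U →
              ∀ σ → (Link cone w σ ∧ Induced cone U σ) ≡ mem K σ
  cone-link {U} K⊆Z_U U<w σ with all (_∈ᵇ U) σ in σ⊆U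
  ... | false = trans (∧-zeroʳ _) (sym (¬-not λ Kσ →
    contradiction (trans (sym (∧-conicalˡ _ _ (K⊆Z_U σ Kσ))) σ⊆U) λ ()))
  ... | true = link-inside (InΔ⇒∉ (All-⊆ˡ (all-∈ᵇ⇒⊆ˡ σ σ⊆U) U<w))
    where
    link-inside : w ∉ σ → (Link cone w σ ∧ mem cone σ) ≡ mem K σ
    link-inside w∉σ
      rewrite cone-apex w∉σ | cone-away w∉σ | ∉⇒∈ᵇ≡false w∉σ | nonEmptyᵇ∧withEmpty K σ
      = ∧-absorbs-implied λ Kσ → ∧-conicalʳ _ _ (K⊆Z_U σ Kσ)

-- Extension tasks

Task : Set
Task = List ℕ × List (List ℕ)

Solves : Task → Complex → Set
Solves (U , F) X = ∃[ v ] (Vertex X v × v ∉ U ×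
  (∀ σ → (Link X v σ ∧ Induced X U σ) ≡ mem (induced X U ∩ᶜ generated F) σ))

Induced-local : ∀ {n X Y U} → Agree n X Y → InΔ n U →
                ∀ σ → Induced X U σ ≡ Induced Y U σ
Induced-local {U = U} X≐Y U<n σ with all (_∈ᵇ U) σ in σ⊆U
... | false = refl
... | true  = X≐Y σ (All-⊆ˡ (all-∈ᵇ⇒⊆ˡ σ σ⊆U) U<n)

Link∧Induced-local : ∀ {n X Y v U} → Agree n X Y → InΔ n (v ∷ U) →
  ∀ σ → (Link X v σ ∧ Induced X U σ) ≡ (Link Y v σ ∧ Induced Y U σ)
Link∧Induced-local {n} {X} {Y} {v} {U} X≐Y (v<n ∷ U<n) σ with all (_∈ᵇ U) σ in σ⊆U
... | false = trans (∧-zeroʳ _) (sym (∧-zeroʳ _))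
... | true  = cong₂ _∧_
  (cong (λ b → nonEmptyᵇ σ ∧ (not (v ∈ᵇ σ) ∧ b)) (X≐Y (v ∷ σ) (v<n ∷ σ<n)))
  (X≐Y σ σ<n)
  where
  σ<n : InΔ n σ
  σ<n = All-⊆ˡ (all-∈ᵇ⇒⊆ˡ σ σ⊆U) U<n

Solves-open : ∀ t → IsOpen (Solves t)
Solves-open (U , F) X (v , v∈X , v∉U , link) = bound (v ∷ U) , solves
  where
  vU<n : InΔ (bound (v ∷ U)) (v ∷ U)
  vU<n = InΔ-bound (v ∷ U)
  solves : ∀ Y → Agree (bound (v ∷ U)) X Y → Solves (U , F) Y
  solves Y X≐Y = v , trans (sym (X≐Y (v ∷ []) (All.head vU<n ∷ []))) v∈X , v∉U , λ σ → begin
    Link Y v σ ∧ Induced Y U σ     ≡⟨ Link∧Induced-local {X = X} {Y} X≐Y vU<n σ ⟨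
    Link X v σ ∧ Induced X U σ     ≡⟨ link σ ⟩
    Induced X U σ ∧ Generated F σ  ≡⟨ cong (_∧ Generated F σ)
                                        (Induced-local {X = X} {Y} X≐Y (All.tail vU<n) σ) ⟩
    Induced Y U σ ∧ Generated F σ  ∎
    where open ≡-Reasoning

Solves-dense : ∀ t → IsDense (Solves t)
Solves-dense (U , F) Z n = cone , Agree-mono {X = Z} {cone} (m≤m+n n (bound U)) cone-agree ,
  w , vertex , InΔ⇒∉ U<w , λ σ → trans (cone-link K⊆Z_U U<w σ)
    (cong (_∧ Generated F σ) (Induced-local {X = Z} {cone} cone-agree U<w σ))
  where
  w : ℕ
  w = n + bound U
  K : Complex
  K = induced Z U ∩ᶜ generated F
  K⊆Z_U : SubcomplexOf K (Induced Z U)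
  K⊆Z_U σ = ∧-conicalˡ _ _
  open Cone Z K (λ σ Kσ → ∧-conicalʳ _ _ (K⊆Z_U σ Kσ)) w
  U<w : InΔ w U
  U<w = InΔ-mono (m≤n+m (bound U) n) (InΔ-bound U)
  vertex : Vertex cone w
  vertex = cone-apex {[]} λ ()

subsets : List ℕ → List (List ℕ)
subsets []       = [] ∷ []
subsets (x ∷ xs) = map (x ∷_) (subsets xs) ++ subsets xs

filter∈subsets : ∀ {P : ℕ → Set} (P? : Decidable P) xs → filter P? xs ∈ subsets xs
filter∈subsets P? []       = here refl
filter∈subsets P? (x ∷ xs) with does (P? x)
... | true  = ∈-++⁺ˡ (∈-map⁺ (x ∷_) (filter∈subsets P? xs))
... | false = ∈-++⁺ʳ (map (x ∷_) (subsets xs)) (filter∈subsets P? xs)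

facesIn : List ℕ → Complex → List (List ℕ)
facesIn U A = filter (λ τ → mem A τ ≟ᵇ true) (subsets U)

generated-facesIn : ∀ {U} A → SubcomplexOf A (λ σ → all (_∈ᵇ U) σ) →
                    ∀ σ → Generated (facesIn U A) σ ≡ mem A σ
generated-facesIn {U} A A⊆U σ = ⇔→≡ (mk⇔ generated⇒A A⇒generated)
  where
  generated⇒A : Generated (facesIn U A) σ ≡ true → mem A σ ≡ true
  generated⇒A σ∈⟨F⟩ with any⇒∃ _ (facesIn U A) (∧-conicalʳ _ _ σ∈⟨F⟩)
  ... | τ , τ∈F , σ⊆τ = mem-down A σ τ (all-∈ᵇ⇒⊆ˡ σ σ⊆τ) σ≢[]
    (proj₂ (∈-filter⁻ (λ τ → mem A τ ≟ᵇ true) {xs = subsets U} τ∈F))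
    where
    σ≢[] : σ ≢ []
    σ≢[] refl = contradiction σ∈⟨F⟩ λ ()
  A⇒generated : mem A σ ≡ true → Generated (facesIn U A) σ ≡ true
  A⇒generated σ∈A = cong₂ _∧_ (nonEmptyᵇ-true σ≢[]) (∃⇒any _ τ∈F (⊆ˡ⇒all-∈ᵇ τ σ⊆τ))
    where
    σ≢[] : σ ≢ []
    σ≢[] refl = contradiction (trans (sym σ∈A) (mem-[] A)) λ ()
    -- the face σ of A, re-listed in the order of U so that it occurs in subsets U
    τ : List ℕ
    τ = filter (_∈? σ) U
    σ⊆τ : σ ⊆ˡ τ
    σ⊆τ = All.tabulate λ x∈σ →
      ∈-filter⁺ (_∈? σ) {xs = U} (All.lookup (all-∈ᵇ⇒⊆ˡ σ (A⊆U σ σ∈A)) x∈σ) x∈σ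
    τ⊆σ : τ ⊆ˡ σ
    τ⊆σ = All.tabulate λ x∈τ → proj₂ (∈-filter⁻ (_∈? σ) {xs = U} x∈τ)
    τ∈F : τ ∈ facesIn U A
    τ∈F = ∈-filter⁺ (λ τ → mem A τ ≟ᵇ true) (filter∈subsets (_∈? σ) U)
      (trans (mem-ext A τ σ τ⊆σ σ⊆τ) σ∈A)

Solves-all⇒IsRado : ∀ X → (∀ t → Solves t X) → IsRado X
Solves-all⇒IsRado X solves = vertex , extension
  where
  vertex : ∃[ v ] Vertex X v
  vertex = let v , v∈X , _ = solves ([] , []) in v , v∈X
  extension : ExtensionProperty X
  extension U _ A A⊆X_U with solves (U , facesIn U A)
  ... | v , v∈X , v∉U , link = v , v∈X , v∉U , λ σ → begin
    Link X v σ ∧ Induced X U σ                ≡⟨ link σ ⟩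
    Induced X U σ ∧ Generated (facesIn U A) σ ≡⟨ cong (Induced X U σ ∧_) (generated-facesIn {U} A A⊆U σ) ⟩
    Induced X U σ ∧ mem A σ                   ≡⟨ ∧-comm (Induced X U σ) (mem A σ) ⟩
    mem A σ ∧ Induced X U σ                   ≡⟨ ∧-absorbs-implied (A⊆X_U σ) ⟩
    mem A σ                                   ∎
    where
    open ≡-Reasoning
    A⊆U : SubcomplexOf A (λ σ → all (_∈ᵇ U) σ)
    A⊆U σ σ∈A = ∧-conicalˡ _ _ (A⊆X_U σ σ∈A)

-- Enumerating the tasks

bits : ℕᵇ → List Bool
bits 0ᵇ       = []
bits 2[1+ x ] = true ∷ bits x
bits 1+[2 x ] = false ∷ bits x

fromBits : List Bool → ℕᵇ
fromBits []           = 0ᵇ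
fromBits (true ∷ bs)  = 2[1+ fromBits bs ]
fromBits (false ∷ bs) = 1+[2 fromBits bs ]

bits-fromBits : ∀ bs → bits (fromBits bs) ≡ bs
bits-fromBits []           = refl
bits-fromBits (true ∷ bs)  = cong (true ∷_) (bits-fromBits bs)
bits-fromBits (false ∷ bs) = cong (false ∷_) (bits-fromBits bs)

ℕ↠List-Bool : ℕ ↠ List Bool
ℕ↠List-Bool = mk↠ₛ {to = λ n → bits (fromℕ n)} λ bs → toℕᵇ (fromBits bs) ,
  trans (cong bits (fromℕ-toℕ (fromBits bs))) (bits-fromBits bs)

-- A list of naturals is written in unary, each entry terminated by false.
runLengths : List Bool → List ℕ
runLengths []           = []
runLengths (false ∷ bs) = 0 ∷ runLengths bs
runLengths (true ∷ bs)  with runLengths bs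
... | []     = []
... | x ∷ xs = suc x ∷ xs

unary : List ℕ → List Bool
unary []       = []
unary (x ∷ xs) = replicate x true ++ false ∷ unary xs

runLengths-unary : ∀ xs → runLengths (unary xs) ≡ xs
runLengths-unary []       = refl
runLengths-unary (x ∷ xs) = run x
  where
  run : ∀ y → runLengths (replicate y true ++ false ∷ unary xs) ≡ y ∷ xs
  run zero    = cong (0 ∷_) (runLengths-unary xs)
  run (suc y) rewrite run y = refl

List-Bool↠List-ℕ : List Bool ↠ List ℕ
List-Bool↠List-ℕ = mk↠ₛ {to = runLengths} λ xs → unary xs , runLengths-unary xs

map-↠ : ∀ {A B : Set} → A ↠ B → List A ↠ List B
map-↠ {A} {B} f = mk↠ₛ onto
  where
  open Surjection f
  onto : StrictlySurjective _≡_ (map to)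
  onto []       = [] , refl
  onto (y ∷ ys) with strictlySurjective y | onto ys
  ... | x , refl | xs , refl = x ∷ xs , refl

uncons-↠ : ∀ {A : Set} → A → List A ↠ (A × List A)
uncons-↠ {A} a = mk↠ₛ {to = uncons} λ { (x , xs) → x ∷ xs , refl }
  where
  uncons : List A → A × List A
  uncons []       = a , []
  uncons (x ∷ xs) = x , xs

ℕ↠List-ℕ : ℕ ↠ List ℕ
ℕ↠List-ℕ = List-Bool↠List-ℕ ↠-∘ ℕ↠List-Bool

ℕ↠Task : ℕ ↠ Task
ℕ↠Task = uncons-↠ [] ↠-∘ (map-↠ ℕ↠List-ℕ ↠-∘ ℕ↠List-ℕ)

-- Baire's theorem for Ω

module CauchyLimit (Z : ℕ → Complex) (r : ℕ → ℕ)
                   (r-increasing : ∀ k → r k < r (suc k))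
                   (Z-cauchy : ∀ k → Agree (r k) (Z k) (Z (suc k))) where

  r-mono : ∀ {a b} → a ≤′ b → r a ≤ r b
  r-mono ≤′-refl       = ≤-refl
  r-mono (≤′-step a≤b) = ≤-trans (r-mono a≤b) (<⇒≤ (r-increasing _))

  r-inflationary : ∀ k → k ≤ r k
  r-inflationary zero    = z≤n
  r-inflationary (suc k) = <-≤-trans (s≤s (r-inflationary k)) (r-increasing k)

  Z-agree : ∀ {a b} → a ≤′ b → Agree (r a) (Z a) (Z b)
  Z-agree ≤′-refl           σ _    = refl
  Z-agree (≤′-step {b} a≤b) σ σ<ra =
    trans (Z-agree a≤b σ σ<ra) (Z-cauchy b σ (InΔ-mono (r-mono a≤b) σ<ra))

  Z-coherent : ∀ a b σ → InΔ (r a) σ → InΔ (r b) σ → mem (Z a) σ ≡ mem (Z b) σ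
  Z-coherent a b σ σ<ra σ<rb with ≤-total a b
  ... | inj₁ a≤b = Z-agree (≤⇒≤′ a≤b) σ σ<ra
  ... | inj₂ b≤a = sym (Z-agree (≤⇒≤′ b≤a) σ σ<rb)

  settled : ∀ σ → InΔ (r (bound σ)) σ
  settled σ = InΔ-mono (r-inflationary (bound σ)) (InΔ-bound σ)

  limitMem : List ℕ → Bool
  limitMem σ = mem (Z (bound σ)) σ

  limit : Complex
  limit = mkComplex limitMem (mem-[] (Z 0)) λ σ τ σ⊆τ σ≢[] τ∈L →
    trans (Z-coherent (bound σ) (bound τ) σ (settled σ) (All-⊆ˡ σ⊆τ (settled τ)))
          (mem-down (Z (bound τ)) σ τ σ⊆τ σ≢[] τ∈L)

  limit-agree : ∀ k → Agree (r k) (Z k) limit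
  limit-agree k σ σ<rk = Z-coherent k (bound σ) σ σ<rk (settled σ)

baire : (G : ℕ → Complex → Set) → (∀ k → IsOpen (G k)) → (∀ k → IsDense (G k)) →
        IsDense (λ X → ∀ k → G k X)
baire G G-open G-dense X n = limit , limit-agree 0 , limit∈G
  where
  -- the radius outgrows both the previous one and that of a ball around the new point inside G k
  step : ℕ → Complex × ℕ → Complex × ℕ
  step k (Z , r) = let Y , _ , Y∈G = G-dense k Z r in Y , suc (r + proj₁ (G-open k Y Y∈G))
  stage : ℕ → Complex × ℕ
  stage zero    = X , n
  stage (suc k) = step k (stage k)
  open CauchyLimit (proj₁ ∘ stage) (proj₂ ∘ stage)
    (λ k → s≤s (m≤m+n _ _)) (λ k → proj₁ (proj₂ (G-dense k _ _)))
  limit∈G : ∀ k → G k limit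
  limit∈G k = ball limit (Agree-mono {X = proj₁ (stage (suc k))} {limit}
    (≤-trans (m≤n+m s _) (n≤1+n _)) (limit-agree (suc k)))
    where
    Y∈G : G k (proj₁ (stage (suc k)))
    Y∈G = proj₂ (proj₂ (G-dense k (proj₁ (stage k)) (proj₂ (stage k))))
    s : ℕ
    s = proj₁ (G-open k _ Y∈G)
    ball : ∀ Y → Agree s (proj₁ (stage (suc k))) Y → G k Y
    ball = proj₂ (G-open k _ Y∈G)

Residual⇒IsDense : ∀ {P} → Residual P → IsDense P
Residual⇒IsDense (G , G-open , G-dense , G⊆P) X n =
  let Y , X≐Y , Y∈G = baire G G-open G-dense X n in Y , X≐Y , G⊆P Y Y∈G

Iso-refl : ∀ X → Iso X X
Iso-refl X = (λ v → v) , (λ v → v) , (λ _ v∈X → v∈X , refl) , (λ _ v∈X → v∈X , refl) ,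
  λ σ _ → cong (mem X) (sym (map-id σ))

RadoClass-residual : Residual RadoClass
RadoClass-residual = (λ k → Solves (task k)) , (λ k → Solves-open (task k)) ,
  (λ k → Solves-dense (task k)) , λ X solves → X , Solves-all⇒IsRado X (every X solves) , Iso-refl X
  where
  open Surjection ℕ↠Task renaming (to to task)
  every : ∀ X → (∀ k → Solves (task k) X) → ∀ t → Solves t X
  every X solves t = let k , k↦t = strictlySurjective t in subst (λ t → Solves t X) k↦t (solves k)

theorem11p1 : Residual RadoClass × IsDense RadoClass
theorem11p1 = RadoClass-residual , Residual⇒IsDense RadoClass-residual
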